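{- Let $\alpha\in\mathcal{C}_n$, $i\in[n-1]$ and $z\in[n-i-\alpha_i]$. Then: (i) $\widetilde{\alpha^*}=(\widehat\alpha)^*$, where $\widetilde{\alpha^*}$ is the composition with $(\widetilde{\alpha^*})_i=\alpha^*_i-z$ and $(\widetilde{\alpha^*})_m=\alpha^*_m$ for $m\neq i$, and $\widehat\alpha$ is the composition with $\widehat\alpha_i=\alpha_i+z$ and $\widehat\alpha_m=\alpha_m$ for $m\neq i$; (ii) $\widehat J_\alpha(i,z)=\tilde J_{\alpha^*}(i,z)$.
   Context: $[n]=\{1,\dots,n\}$. A (weak) composition is a finite sequence of nonnegative integers $(\alpha_1,\dots,\alpha_m)$ with $\alpha_k=0$ for $k>m$. $\mathcal{C}_n$ is the set of compositions $(\alpha_1,\dots,\alpha_{n-1})$ with $0\leqslant\alpha_i\leqslant n-i$. For $\alpha\in\mathcal{C}_n$, $\alpha^*\in\mathcal{C}_n$ is defined by $\alpha^*_i=n-i-\alpha_i$ for $i\in[n-1]$ (and similarly for any composition of length $n-1$). For a composition $\alpha$, a positive integer $i$ and $j\in\mathbb{N}$: $c_{i,j}(\alpha)=0$ if $j\leqslant i+1$; for $j>i+1$, $c_{i,j}(\alpha)=c_{i,j-1}(\alpha)+1$ if $\alpha_{j-1}<\alpha_i-c_{i,j-1}(\alpha)$ and $c_{i,j}(\alpha)=c_{i,j-1}(\alpha)$ otherwise. For a composition $\beta$ and $z\leqslant\beta_i$, with $\tilde\beta$ given by $\tilde\beta_i=\beta_i-z$, $\tilde\beta_m=\beta_m$ ($m\neq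 i$), set $\tilde J_\beta(i,z)=\max\{j>i:c_{i,j}(\beta)=c_{i,j}(\tilde\beta)\}$. For $\alpha$ and $\widehat\alpha$ as in the claim, $\widehat J_\alpha(i,z)=\max\{j>i:c_{i,j}(\alpha)=c_{i,j}(\widehat\alpha)\}$. -}

module Defs where

open import Data.Nat using (ℕ; zero; suc; _+_; _∸_; _≤_; _<_; _<ᵇ_; _≤ᵇ_)
open import Data.Bool using (if_then_else_)
open import Data.List using (List; []; _∷_; length)
open import Data.Product using (_×_)
open import Relation.Binary.PropositionalEquality using (_≡_; _≢_)

-- Compositions are finite lists of naturals; entries are 1-indexed and
-- every entry beyond the length is 0.
Composition : Set
Composition = List ℕ

_at_ : Composition → ℕ → ℕ
[] at _ = 0
(x ∷ xs) at zero = 0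
(x ∷ xs) at suc zero = x
(x ∷ xs) at suc (suc k) = xs at suc k

InC : ℕ → Composition → Set
InC n α = (length α ≡ n ∸ 1) × (∀ i → 1 ≤ i → i ≤ n ∸ 1 → α at i ≤ n ∸ i)

starFrom : ℕ → ℕ → Composition → Composition
starFrom n k [] = []
starFrom n k (x ∷ xs) = (n ∸ k ∸ x) ∷ starFrom n (suc k) xs

star : ℕ → Composition → Composition
star n α = starFrom n 1 α

update : Composition → ℕ → (ℕ → ℕ) → Composition
update [] _ f = []
update (x ∷ xs) zero f = x ∷ xs
update (x ∷ xs) (suc zero) f = f x ∷ xs
update (x ∷ xs) (suc (suc k)) f = x ∷ update xs (suc k) f

hat : Composition → ℕ → ℕ → Composition
hat α i z = update α i (λ a → a + z)

tilde : Composition → ℕ → ℕ → Composition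
tilde β i z = update β i (λ b → b ∸ z)

-- c_{i,j}(α): 0 if j ≤ i+1; otherwise c_{i,j-1}+1 if α_{j-1} < α_i - c_{i,j-1},
-- else c_{i,j-1}.  (Truncated subtraction: α_{j-1} < α_i - c is false whenever
-- α_i - c < 0, matching α_{j-1} < α_i ∸ c.)
c : Composition → ℕ → ℕ → ℕ
c α i zero = 0
c α i (suc j) =
  if suc j ≤ᵇ suc i then 0
  else (if (α at j) <ᵇ ((α at i) ∸ c α i j) then suc (c α i j) else c α i j)

IsMaxAgree : Composition → Composition → ℕ → ℕ → Set
IsMaxAgree α β i j =
  (i < j) × (c α i j ≡ c β i j) × (∀ k → j < k → c α i k ≢ c β i k)

{-# OPTIONS --safe #-}
-- The counters c_{i,·}(α) and c_{i,·}(α̂) read the same data α_j against the thresholds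
-- α_i and α_i + z; the counters c_{i,·}(α*) and c_{i,·}(α̃*) read α*_j = n − j − α_j against
-- α*_i − z and α*_i.  While a pair agrees, its two counters move together, and because
-- α_j + α*_j is the sum of the remaining budgets of the two pairs plus z − 1, at each step
-- exactly one pair moves, until α_j lands in the window [budget, budget + z) of the first
-- pair.  There, in both pairs at once, only the counter with the larger threshold moves;
-- afterwards that counter stays ahead forever, since its remaining budget never falls below
-- its partner's.  So both pairs agree for the last time at the same j.
module Submission where

open import Defs
open import Data.Nat
  using (ℕ; zero; suc; _+_; _∸_; _≤_; _<_; _<ᵇ_; _≤ᵇ_; z≤n; s≤s; _<?_; _≤?_; _≤′_; ≤′-refl; ≤′-step)
open import Data.Nat.Properties
open import Data.Bool using (true; false; if_then_else_; T)
open import Data.Unit using (tt)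
open import Data.List using ([]; _∷_; length)
open import Data.Product using (_×_; _,_; proj₁; proj₂; map₂; ∃-syntax)
open import Data.Empty using (⊥-elim)
open import Function using (_∘_)
open import Relation.Nullary using (yes; no)
open import Relation.Binary.PropositionalEquality
  using (_≡_; _≢_; refl; sym; trans; cong; cong₂; subst; module ≡-Reasoning)
open import Algebra.Properties.CommutativeSemigroup +-commutativeSemigroup using (interchange; xy∙z≈xz∙y)

+-≤-complement : ∀ {x y u v} → x + y ≡ u + v → x ≤ u → v ≤ y
+-≤-complement {x} {y} {u} {v} eq x≤u =
  +-cancelˡ-≤ x v y (≤-trans (+-monoˡ-≤ v x≤u) (≤-reflexive (sym eq)))

+-<-complement : ∀ {x y u v} → x + y ≡ u + v → x < u → v < y
+-<-complement {x} {y} {u} {v} eq x<u =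
  +-cancelˡ-< x v y (<-≤-trans (+-monoˡ-< v x<u) (≤-reflexive (sym eq)))

module _ {x y p q w : ℕ} (sum : x + y ≡ p + q + w) where

  below-window : x < p → q + suc w ≤ y
  below-window x<p = subst (_≤ y) (sym (+-suc q w)) (+-<-complement (trans sum (+-assoc p q w)) x<p)

  above-window : p + suc w ≤ x → y < q
  above-window p+w<x =
    +-<-complement (trans (sym (xy∙z≈xz∙y p q w)) (sym sum)) (subst (_≤ x) (+-suc p w) p+w<x)

  in-window : p ≤ x → x < p + suc w → q ≤ y × y < q + suc w
  in-window p≤x x<p+w =
    +-≤-complement (trans sum (xy∙z≈xz∙y p q w)) (≤-pred (subst (x <_) (+-suc p w) x<p+w)) ,
    subst (y <_) (sym (+-suc q w)) (s≤s (+-≤-complement (sym (trans sum (+-assoc p q w))) p≤x))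

step : ℕ → ℕ → ℕ → ℕ
step x t k = if x <ᵇ t ∸ k then suc k else k

step-< : ∀ {x k h} → x < h → step x (k + h) k ≡ suc k
step-< {x} {k} {h} x<h with x <ᵇ k + h ∸ k in eq
... | true  = refl
... | false = ⊥-elim (subst T eq (<⇒<ᵇ (subst (x <_) (sym (m+n∸m≡n k h)) x<h)))

step-≥ : ∀ {x k h} → h ≤ x → step x (k + h) k ≡ k
step-≥ {x} {k} {h} h≤x with x <ᵇ k + h ∸ k in eq
... | false = refl
... | true  =
  ⊥-elim (<⇒≱ (subst (x <_) (m+n∸m≡n k h) (<ᵇ⇒< x (k + h ∸ k) (subst T (sym eq) tt))) h≤x)

-- The recursion defining c_{i,j}(α), with α_{j−1} abstracted to W (j − 1) and α_i to t.
record Counter (W : ℕ → ℕ) (t i : ℕ) (C : ℕ → ℕ) : Set where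
  constructor counting
  field counts : ∀ j → i < j → C (suc j) ≡ step (W j) t (C j)

module _ {W C : ℕ → ℕ} {t i : ℕ} (counter : Counter W t i C) {k h : ℕ} (i<k : i < k) where

  counter-bumps : t ≡ C k + h → W k < h → C (suc k) ≡ suc (C k)
  counter-bumps refl W<h = trans (Counter.counts counter k i<k) (step-< W<h)

  counter-stays : t ≡ C k + h → h ≤ W k → C (suc k) ≡ C k
  counter-stays refl h≤W = trans (Counter.counts counter k i<k) (step-≥ h≤W)

c-counter : ∀ β i → Counter (β at_) (β at i) i (c β i)
c-counter β i = counting counts
  where
  counts : ∀ j → i < j → c β i (suc j) ≡ step (β at j) (β at i) (c β i j)
  counts j i<j with suc j ≤ᵇ suc i in eq
  ... | false = refl
  ... | true  = ⊥-elim (<⇒≱ i<j (≤-pred (≤ᵇ⇒≤ (suc j) (suc i) (subst T (sym eq) tt))))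

c-start : ∀ β i → c β i (suc i) ≡ 0
c-start β i with suc i ≤ᵇ suc i in eq
... | true  = refl
... | false = ⊥-elim (subst T eq (≤⇒≤ᵇ (≤-refl {suc i})))

LastAgreement : (ℕ → ℕ) → (ℕ → ℕ) → ℕ → ℕ → Set
LastAgreement L U i j = (i < j) × (L j ≡ U j) × (∀ k → j < k → L k ≢ U k)

LastAgreement-sym : ∀ {L U i j} → LastAgreement L U i j → LastAgreement U L i j
LastAgreement-sym (i<j , L≡U , disagree) = i<j , sym L≡U , λ k j<k → disagree k j<k ∘ sym

module CounterPair {W L U : ℕ → ℕ} {i t z : ℕ}
  (lower : Counter W t i L) (upper : Counter W (t + z) i U) where

  Tied : ℕ → ℕ → Set
  Tied p k = (L k ≡ U k) × (t ≡ L k + p)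

  -- Once U is ahead of L, its remaining budget (t + z) − U k = budget + slack is at least
  -- that of L, so whenever L moves U moves too and the gap never closes.
  Ahead : ℕ → Set
  Ahead k = ∃[ gap ] ∃[ slack ] ∃[ budget ]
    (U k ≡ L k + suc gap) × (z ≡ suc gap + slack) × (t ≡ L k + budget)

  private
    upper-budget : ∀ {k p} → L k ≡ U k → t ≡ L k + p → t + z ≡ U k + (p + z)
    upper-budget {k} {p} L≡U t≡ = trans (cong (_+ z) (trans t≡ (cong (_+ p) L≡U))) (+-assoc (U k) p z)

    ahead-upper-budget : ∀ {k gap slack budget} → U k ≡ L k + suc gap → z ≡ suc gap + slack →
      t ≡ L k + budget → t + z ≡ U k + (budget + slack)
    ahead-upper-budget {k} {gap} {slack} {budget} U≡ z≡ t≡ = begin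
      t + z                              ≡⟨ cong₂ _+_ t≡ z≡ ⟩
      (L k + budget) + (suc gap + slack) ≡⟨ interchange (L k) budget (suc gap) slack ⟩
      (L k + suc gap) + (budget + slack) ≡⟨ cong (_+ (budget + slack)) (sym U≡) ⟩
      U k + (budget + slack)             ∎
      where open ≡-Reasoning

  tied-start : ∀ {k} → L k ≡ 0 → U k ≡ 0 → Tied t k
  tied-start L≡0 U≡0 = trans L≡0 (sym U≡0) , cong (_+ t) (sym L≡0)

  tied-bump : ∀ {p k} → i < k → Tied (suc p) k → W k < suc p → Tied p (suc k)
  tied-bump {p} {k} i<k (L≡U , t≡) W<p =
    trans L-bumps (trans (cong suc L≡U) (sym U-bumps)) ,
    trans t≡ (trans (+-suc (L k) p) (cong (_+ p) (sym L-bumps)))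
    where
    L-bumps : L (suc k) ≡ suc (L k)
    L-bumps = counter-bumps lower i<k t≡ W<p
    U-bumps : U (suc k) ≡ suc (U k)
    U-bumps = counter-bumps upper i<k (upper-budget L≡U t≡) (≤-trans W<p (m≤m+n _ z))

  tied-stay : ∀ {p k} → i < k → Tied p k → p + z ≤ W k → Tied p (suc k)
  tied-stay {p} {k} i<k (L≡U , t≡) p+z≤W =
    trans L-stays (trans L≡U (sym U-stays)) , trans t≡ (cong (_+ p) (sym L-stays))
    where
    L-stays : L (suc k) ≡ L k
    L-stays = counter-stays lower i<k t≡ (≤-trans (m≤m+n p z) p+z≤W)
    U-stays : U (suc k) ≡ U k
    U-stays = counter-stays upper i<k (upper-budget L≡U t≡) p+z≤W

  tied-split : ∀ {p k} → i < k → Tied p k → p ≤ W k → W k < p + z → Ahead (suc k)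
  tied-split {p} {k} i<k (L≡U , t≡) p≤W W<p+z =
    0 , z ∸ 1 , p ,
    trans U-bumps (trans (cong suc (sym L≡U)) (trans (+-comm 1 (L k)) (cong (_+ 1) (sym L-stays)))) ,
    sym (m+[n∸m]≡n 1≤z) ,
    trans t≡ (cong (_+ p) (sym L-stays))
    where
    L-stays : L (suc k) ≡ L k
    L-stays = counter-stays lower i<k t≡ p≤W
    U-bumps : U (suc k) ≡ suc (U k)
    U-bumps = counter-bumps upper i<k (upper-budget L≡U t≡) W<p+z
    1≤z : 1 ≤ z
    1≤z = +-cancelˡ-< p 0 z (≤-<-trans (≤-reflexive (+-identityʳ p)) (≤-<-trans p≤W W<p+z))

  ahead-suc : ∀ {k} → i < k → Ahead k → Ahead (suc k)
  ahead-suc {k} i<k (gap , slack , budget , U≡ , z≡ , t≡)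
    with W k <? budget | W k <? budget + slack
  ahead-suc {k} i<k (gap , slack , zero , U≡ , z≡ , t≡) | yes () | _
  ahead-suc {k} i<k (gap , slack , suc budget , U≡ , z≡ , t≡) | yes W<budget | _ =
    gap , slack , budget ,
    trans U-bumps (trans (cong suc U≡) (cong (_+ suc gap) (sym L-bumps))) ,
    z≡ ,
    trans t≡ (trans (+-suc (L k) budget) (cong (_+ budget) (sym L-bumps)))
    where
    L-bumps : L (suc k) ≡ suc (L k)
    L-bumps = counter-bumps lower i<k t≡ W<budget
    U-bumps : U (suc k) ≡ suc (U k)
    U-bumps = counter-bumps upper i<k (ahead-upper-budget U≡ z≡ t≡) (≤-trans W<budget (m≤m+n _ slack))
  ahead-suc {k} i<k (gap , zero , budget , U≡ , z≡ , t≡) | no W≮budget | yes W<budget+0 =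
    ⊥-elim (W≮budget (subst (W k <_) (+-identityʳ budget) W<budget+0))
  ahead-suc {k} i<k (gap , suc slack , budget , U≡ , z≡ , t≡) | no W≮budget | yes W<budget+slack =
    suc gap , slack , budget ,
    trans U-bumps (trans (cong suc U≡)
      (trans (sym (+-suc (L k) (suc gap))) (cong (_+ suc (suc gap)) (sym L-stays)))) ,
    trans z≡ (cong suc (+-suc gap slack)) ,
    trans t≡ (cong (_+ budget) (sym L-stays))
    where
    L-stays : L (suc k) ≡ L k
    L-stays = counter-stays lower i<k t≡ (≮⇒≥ W≮budget)
    U-bumps : U (suc k) ≡ suc (U k)
    U-bumps = counter-bumps upper i<k (ahead-upper-budget U≡ z≡ t≡) W<budget+slack
  ahead-suc {k} i<k (gap , slack , budget , U≡ , z≡ , t≡) | no W≮budget | no W≮budget+slack =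
    gap , slack , budget ,
    trans U-stays (trans U≡ (cong (_+ suc gap) (sym L-stays))) ,
    z≡ ,
    trans t≡ (cong (_+ budget) (sym L-stays))
    where
    L-stays : L (suc k) ≡ L k
    L-stays = counter-stays lower i<k t≡ (≤-trans (m≤m+n budget slack) (≮⇒≥ W≮budget+slack))
    U-stays : U (suc k) ≡ U k
    U-stays = counter-stays upper i<k (ahead-upper-budget U≡ z≡ t≡) (≮⇒≥ W≮budget+slack)

  ahead-forever : ∀ {k m} → i < k → Ahead k → k ≤′ m → Ahead m
  ahead-forever i<k ahead ≤′-refl = ahead
  ahead-forever i<k ahead (≤′-step k≤′m) =
    ahead-suc (<-≤-trans i<k (≤′⇒≤ k≤′m)) (ahead-forever i<k ahead k≤′m)

  ahead-disagree : ∀ {k} → Ahead k → L k ≢ U k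
  ahead-disagree {k} (_ , _ , _ , U≡ , _) L≡U = m+1+n≢m (L k) (sym (trans L≡U U≡))

  last-agreement : ∀ {j} → i < j → L j ≡ U j → Ahead (suc j) → LastAgreement L U i j
  last-agreement i<j L≡U ahead =
    i<j , L≡U , λ m j<m → ahead-disagree (ahead-forever (m<n⇒m<1+n i<j) ahead (≤⇒≤′ j<m))

module JointSearch {X Y L₁ U₁ L₂ U₂ : ℕ → ℕ} {i s t z′ n : ℕ}
  (lower₁ : Counter X s i L₁) (upper₁ : Counter X (s + suc z′) i U₁)
  (lower₂ : Counter Y t i L₂) (upper₂ : Counter Y (t + suc z′) i U₂)
  (complementary : ∀ j → i < j → X j + Y j ≡ n ∸ j) where

  module P₁ = CounterPair lower₁ upper₁
  module P₂ = CounterPair lower₂ upper₂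

  CommonLastAgreement : Set
  CommonLastAgreement = ∃[ j ] (LastAgreement L₁ U₁ i j × LastAgreement L₂ U₂ i j)

  private
    data-sum : ∀ p q {k} → i < k → k + (p + q + z′) ≡ n → X k + Y k ≡ p + q + z′
    data-sum p q {k} i<k sum = trans (complementary k i<k) (trans (cong (_∸ k) (sym sum)) (m+n∸m≡n k _))

  -- p and q are the budgets of the tied pairs; every step spends exactly one unit of
  -- p + q until the data falls into the window where only the upper counters move.
  search : ∀ p q k → i < k → P₁.Tied p k → P₂.Tied q k → k + (p + q + z′) ≡ n → CommonLastAgreement
  search p q k i<k tied₁ tied₂ sum with X k <? p | X k <? p + suc z′
  search zero q k i<k tied₁ tied₂ sum | yes () | _
  search (suc p) q k i<k tied₁ tied₂ sum | yes X<p | _ =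
    search p q (suc k) (m<n⇒m<1+n i<k)
      (P₁.tied-bump i<k tied₁ X<p) (P₂.tied-stay i<k tied₂ (below-window (data-sum (suc p) q i<k sum) X<p))
      (trans (sym (+-suc k (p + q + z′))) sum)
  search p zero k i<k tied₁ tied₂ sum | no _ | no X≮p+z =
    ⊥-elim (n≮0 (above-window (data-sum p 0 i<k sum) (≮⇒≥ X≮p+z)))
  search p (suc q) k i<k tied₁ tied₂ sum | no _ | no X≮p+z =
    search p q (suc k) (m<n⇒m<1+n i<k)
      (P₁.tied-stay i<k tied₁ (≮⇒≥ X≮p+z))
      (P₂.tied-bump i<k tied₂ (above-window (data-sum p (suc q) i<k sum) (≮⇒≥ X≮p+z)))
      (trans (sym (+-suc k (p + q + z′))) (trans (cong (λ r → k + (r + z′)) (sym (+-suc p q))) sum))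
  search p q k i<k tied₁ tied₂ sum | no X≮p | yes X<p+z =
    k ,
    P₁.last-agreement i<k (proj₁ tied₁) (P₁.tied-split i<k tied₁ (≮⇒≥ X≮p) X<p+z) ,
    P₂.last-agreement i<k (proj₁ tied₂) (P₂.tied-split i<k tied₂ (proj₁ Y-in-window) (proj₂ Y-in-window))
    where
    Y-in-window : q ≤ Y k × Y k < q + suc z′
    Y-in-window = in-window (data-sum p q i<k sum) (≮⇒≥ X≮p) X<p+z

  common-last-agreement : L₁ (suc i) ≡ 0 → U₁ (suc i) ≡ 0 → L₂ (suc i) ≡ 0 → U₂ (suc i) ≡ 0 →
    suc i + (s + t + z′) ≡ n → CommonLastAgreement
  common-last-agreement L₁≡0 U₁≡0 L₂≡0 U₂≡0 =
    search s t (suc i) (n<1+n i) (P₁.tied-start L₁≡0 U₁≡0) (P₂.tied-start L₂≡0 U₂≡0)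

at-update-same : ∀ β i f → 1 ≤ i → i ≤ length β → update β i f at i ≡ f (β at i)
at-update-same (x ∷ xs) (suc zero)    f _ _         = refl
at-update-same (x ∷ xs) (suc (suc i)) f _ (s≤s i≤) = at-update-same xs (suc i) f (s≤s z≤n) i≤

at-update-other : ∀ β i f k → i < k → update β i f at k ≡ β at k
at-update-other []       i             f k             _         = refl
at-update-other (x ∷ xs) zero          f k             _         = refl
at-update-other (x ∷ xs) (suc zero)    f (suc zero)    (s≤s ())
at-update-other (x ∷ xs) (suc zero)    f (suc (suc k)) _         = refl
at-update-other (x ∷ xs) (suc (suc i)) f (suc (suc k)) (s≤s i<k) = at-update-other xs (suc i) f (suc k) i<k

at-beyond-length : ∀ β k → length β < k → β at k ≡ 0
at-beyond-length []       k             _          = refl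
at-beyond-length (x ∷ xs) (suc (suc k)) (s≤s len<) = at-beyond-length xs (suc k) len<

c-update-counter : ∀ β i f → 1 ≤ i → i ≤ length β → Counter (β at_) (f (β at i)) i (c (update β i f) i)
c-update-counter β i f 1≤i i≤len = counting λ j i<j →
  trans (Counter.counts (c-counter (update β i f) i) j i<j)
        (cong₂ (λ x t → step x t (c (update β i f) i j))
               (at-update-other β i f j i<j) (at-update-same β i f 1≤i i≤len))

length-starFrom : ∀ n m β → length (starFrom n m β) ≡ length β
length-starFrom n m []       = refl
length-starFrom n m (x ∷ xs) = cong suc (length-starFrom n (suc m) xs)

starFrom-at : ∀ n m β k → 1 ≤ k → k ≤ length β → starFrom n (suc m) β at k ≡ n ∸ (m + k) ∸ (β at k)
starFrom-at n m (x ∷ xs) (suc zero)    _ _         = cong (λ r → n ∸ r ∸ x) (+-comm 1 m)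
starFrom-at n m (x ∷ xs) (suc (suc k)) _ (s≤s k≤) =
  trans (starFrom-at n (suc m) xs (suc k) (s≤s z≤n) k≤)
        (cong (λ r → n ∸ r ∸ (xs at suc k)) (sym (+-suc m (suc k))))

star-at : ∀ n α k → length α ≡ n ∸ 1 → 1 ≤ k → star n α at k ≡ n ∸ k ∸ (α at k)
star-at n α k length≡ 1≤k with k ≤? length α
... | yes k≤len = starFrom-at n 0 α k 1≤k k≤len
... | no k≰len = begin
  star n α at k       ≡⟨ at-beyond-length (star n α) k star-short ⟩
  0                   ≡⟨ sym (0∸n≡0 (α at k)) ⟩
  0 ∸ (α at k)        ≡⟨ cong (_∸ (α at k)) (sym (m≤n⇒m∸n≡0 n≤k)) ⟩
  n ∸ k ∸ (α at k)    ∎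
  where
  open ≡-Reasoning
  star-short : length (star n α) < k
  star-short = subst (_< k) (sym (length-starFrom n 1 α)) (≰⇒> k≰len)
  n≤k : n ≤ k
  n≤k = ≤-trans (m≤n+m∸n n 1) (subst (_< k) length≡ (≰⇒> k≰len))

tilde-starFrom : ∀ n m α i z → tilde (starFrom n m α) i z ≡ starFrom n m (hat α i z)
tilde-starFrom n m []       i             z = refl
tilde-starFrom n m (x ∷ xs) zero          z = refl
tilde-starFrom n m (x ∷ xs) (suc zero)    z = cong (_∷ starFrom n (suc m) xs) (∸-+-assoc (n ∸ m) x z)
tilde-starFrom n m (x ∷ xs) (suc (suc i)) z = cong (n ∸ m ∸ x ∷_) (tilde-starFrom n (suc m) xs (suc i) z)

InC-at-≤ : ∀ n α → InC n α → ∀ j → 1 ≤ j → α at j ≤ n ∸ j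
InC-at-≤ n α (length≡ , bounded) j 1≤j with j ≤? n ∸ 1
... | yes j≤n∸1 = bounded j 1≤j j≤n∸1
... | no j≰n∸1 rewrite at-beyond-length α j (subst (_< j) (sym length≡) (≰⇒> j≰n∸1)) = z≤n

at+star-at : ∀ n α → InC n α → ∀ j → 1 ≤ j → α at j + star n α at j ≡ n ∸ j
at+star-at n α αC@(length≡ , _) j 1≤j = begin
  α at j + star n α at j        ≡⟨ cong (α at j +_) (star-at n α j length≡ 1≤j) ⟩
  α at j + (n ∸ j ∸ (α at j))   ≡⟨ m+[n∸m]≡n (InC-at-≤ n α αC j 1≤j) ⟩
  n ∸ j                         ∎
  where open ≡-Reasoning

lemma3p10 : (n : ℕ) (α : Composition) → InC n α →
    (i : ℕ) → 1 ≤ i → i ≤ n ∸ 1 →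
    (z : ℕ) → 1 ≤ z → z ≤ n ∸ i ∸ (α at i) →
    (tilde (star n α) i z ≡ star n (hat α i z))
    × (∃[ j ] (IsMaxAgree α (hat α i z) i j × IsMaxAgree (star n α) (tilde (star n α) i z) i j))
lemma3p10 n α αC i 1≤i i≤n∸1 zero () z≤b
lemma3p10 n α αC@(length≡ , _) i 1≤i i≤n∸1 (suc z′) _ z≤b =
  tilde-starFrom n 1 α i z ,
  map₂ (map₂ LastAgreement-sym)
    (common-last-agreement (c-start α i) (c-start _ i) (c-start _ i) (c-start _ i) budgets)
  where
  z = suc z′
  i≤length : i ≤ length α
  i≤length = subst (i ≤_) (sym length≡) i≤n∸1
  z≤star : z ≤ star n α at i
  z≤star = subst (z ≤_) (sym (star-at n α i length≡ 1≤i)) z≤b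
  open JointSearch
    (c-counter α i) (c-update-counter α i (_+ z) 1≤i i≤length)
    (c-update-counter (star n α) i (_∸ z) 1≤i (subst (i ≤_) (sym (length-starFrom n 1 α)) i≤length))
    (subst (λ t → Counter (star n α at_) t i (c (star n α) i)) (sym (m∸n+n≡m z≤star))
           (c-counter (star n α) i))
    (λ j i<j → at+star-at n α αC j (≤-trans 1≤i (<⇒≤ i<j)))
  budgets : suc i + (α at i + (star n α at i ∸ z) + z′) ≡ n
  budgets = begin
    suc i + (α at i + (star n α at i ∸ z) + z′)  ≡⟨ sym (+-suc i _) ⟩
    i + suc (α at i + (star n α at i ∸ z) + z′)  ≡⟨ cong (i +_) (sym (+-suc _ z′)) ⟩
    i + (α at i + (star n α at i ∸ z) + z)       ≡⟨ cong (i +_) (+-assoc (α at i) _ z) ⟩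
    i + (α at i + (star n α at i ∸ z + z))       ≡⟨ cong (λ r → i + (α at i + r)) (m∸n+n≡m z≤star) ⟩
    i + (α at i + star n α at i)                 ≡⟨ cong (i +_) (at+star-at n α αC i 1≤i) ⟩
    i + (n ∸ i)                                  ≡⟨ m+[n∸m]≡n (≤-trans i≤n∸1 (m∸n≤m n 1)) ⟩
    n                                            ∎
    where open ≡-Reasoning
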